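{- Let $m \geq 2$ be an integer and let $D$ be a weakly connected digraph such that the $m$-step competition graph $C^m(D)$ is triangle-free and the number of sources of $D$ equals the number of components of $C^m(D)$. Then each component of $C^m(D)$ is a nontrivial star graph whose center is a source in $D$, and $D$ is a star-generating digraph.
   Context: All digraphs are finite, may have loops, and (standing assumption) every vertex has outdegree at least $1$. For a positive integer $m$, a vertex $y$ is an $m$-step prey of $x$ (and $x$ an $m$-step predator of $y$) if there is a directed walk of length $m$ from $x$ to $y$; $1$-step prey/predators are called prey/predators. The $m$-step competition graph $C^m(D)$ has vertex set $V(D)$ and an edge between distinct vertices $x,y$ iff they have a common $m$-step prey. A source is a vertex of indegree $0$. $D$ is weakly connected if its underlying undirected graph is connected. A weakly connected digraph $D$ is star-generating if: ($S_1$) $D$ has at least one source and, for each source $v$, each prey of $v$ has exactly two predators; ($S_2$) no two sources of $D$ have a common prey; ($S_3$) each non-source vertex has exactly one prey and exactly two predators, one of which is a source and the other of which is a non-source vertex. A star graph is $K_{1,r}$ ($r \ge 0$) with center the vertex of degree $r$; it is nontrivial if it has at least two vertices. -}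

module Defs where

open import Data.Nat using (ℕ; zero; suc; _≥_)
open import Data.Fin using (Fin)
open import Data.Fin.Properties using (all?)
open import Data.Bool using (Bool; true; false; _≟_)
open import Data.List using (length; filter)
open import Data.List.Base using ()
open import Data.Fin.Base using ()
open import Data.List using (List)
open import Data.Product using (Σ; ∃; _×_; _,_)
open import Data.Sum using (_⊎_)
open import Relation.Nullary using (¬_; Dec)
open import Relation.Binary.PropositionalEquality using (_≡_; _≢_)
open import Relation.Binary.Construct.Closure.ReflexiveTransitive using (Star)
open import Function.Bundles using (_⇔_)
open import Function.Definitions using (Surjective)

-- A finite digraph on vertex set Fin n (loops allowed), given by its
-- Boolean adjacency matrix: D x y ≡ true iff there is an arc x → y.
Digraph : ℕ → Set
Digraph n = Fin n → Fin n → Bool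

module _ {n : ℕ} (D : Digraph n) where

  Arc : Fin n → Fin n → Set
  Arc x y = D x y ≡ true

  -- standing assumption: every vertex has outdegree at least 1
  OutdegPositive : Set
  OutdegPositive = ∀ x → ∃ λ y → Arc x y

  Walk : ℕ → Fin n → Fin n → Set
  Walk zero    x y = x ≡ y
  Walk (suc m) x y = ∃ λ z → Arc x z × Walk m z y

  Source : Fin n → Set
  Source v = ∀ u → D u v ≡ false

  source? : ∀ v → Dec (Source v)
  source? v = all? (λ u → D u v ≟ false)

  numSources : ℕ
  numSources = length (filter source? (Data.List.allFin n))
    where import Data.List

  UAdj : Fin n → Fin n → Set
  UAdj x y = Arc x y ⊎ Arc y x

  WeaklyConnected : Set
  WeaklyConnected = Fin n × (∀ x y → Star UAdj x y)

  CmEdge : ℕ → Fin n → Fin n → Set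
  CmEdge m x y = x ≢ y × (∃ λ z → Walk m x z × Walk m y z)

  CmConn : ℕ → Fin n → Fin n → Set
  CmConn m = Star (CmEdge m)

  CmTriangleFree : ℕ → Set
  CmTriangleFree m = ∀ x y z → ¬ (CmEdge m x y × CmEdge m y z × CmEdge m x z)

  -- C^m(D) has exactly k components: a surjective labelling of vertices
  -- by Fin k whose fibres are exactly the connected components.
  CmHasComponents : ℕ → ℕ → Set
  CmHasComponents m k =
    Σ (Fin n → Fin k) λ c → Surjective _≡_ _≡_ c × (∀ x y → (c x ≡ c y) ⇔ CmConn m x y)

  -- the component of C^m(D) containing x is a nontrivial star (as an induced
  -- subgraph) whose center is a source of D
  ComponentIsSourceCenteredStar : ℕ → Fin n → Set
  ComponentIsSourceCenteredStar m x =
    ∃ λ c → Source c × CmConn m c x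
      × (∃ λ y → CmConn m c y × y ≢ c)
      × (∀ y z → CmConn m c y → CmConn m c z →
           CmEdge m y z ⇔ (y ≢ z × (y ≡ c ⊎ z ≡ c)))

  ExactlyTwoPredators : Fin n → Set
  ExactlyTwoPredators w =
    ∃ λ p → ∃ λ q → p ≢ q × Arc p w × Arc q w × (∀ r → Arc r w → r ≡ p ⊎ r ≡ q)

  StarGenerating : Set
  StarGenerating =
    WeaklyConnected
    × (∃ λ v → Source v)
    × (∀ v w → Source v → Arc v w → ExactlyTwoPredators w)
    × (∀ u v → Source u → Source v → u ≢ v → ¬ (∃ λ w → Arc u w × Arc v w))
    × (∀ x → ¬ Source x →
         (∃ λ y → Arc x y × (∀ y′ → Arc x y′ → y′ ≡ y))
         × (∃ λ p → ∃ λ q → Source p × ¬ Source q × Arc p x × Arc q x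
              × (∀ r → Arc r x → r ≡ p ⊎ r ≡ q)))

-- Let k be the number of sources, which is also the number of components of C^m(D).
-- Triangle-freeness means that every vertex has at most two m-step predators.  Fix a root in
-- every component; each other vertex x has a neighbour p one step closer to its root along a
-- shortest path, and a common m-step prey of x and p, the parent prey of x.  Parent preys are
-- non-sources and x ↦ parent prey is injective on the at least n − k non-roots, while there
-- are only n − k non-sources; so every non-source has exactly two m-step predators, and
-- comparing depths shows that two vertices share at most one m-step prey.  A second count,
-- together with descent on depth, shows that every non-source even has two distinct
-- (m − 1)-step predators.  Hence a non-source has a single prey, no two non-sources share a
-- prey, and the predators of a non-source are one source and one non-source.  A component of
-- C^m(D) is then the star formed by a source and the vertices sharing a prey with it.

module Submission where

open import Defs
open import Data.Bool using (true)
import Data.Bool.Properties as Bool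
open import Data.Empty using (⊥-elim)
open import Data.Fin using (Fin; zero; suc)
open import Data.Fin.Properties using (any?; all?; _≟_; injective⇒≤; suc-injective)
open import Data.List using (length; filter; tabulate)
open import Data.Nat using (ℕ; zero; suc; _+_; _≤_; _<_; _≥_; z≤n; s≤s)
open import Data.Nat.Induction using (<-wellFounded)
open import Data.Nat.Properties using (+-suc; <-asym; <-irrefl)
import Data.Nat.Properties as ℕ
open import Data.Product using (∃; ∃₂; _×_; _,_; proj₁; proj₂)
open import Data.Sum using (_⊎_; inj₁; inj₂)
import Data.Sum as Sum
open import Function using (_∘_)
open import Function.Bundles using (_⇔_; mk⇔; Equivalence)
open import Function.Definitions using (Surjective)
open import Induction.WellFounded using (Acc; acc)
open import Level using (0ℓ)
open import Relation.Binary using (Rel) renaming (Decidable to Decidable₂)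
open import Relation.Binary.Construct.Closure.ReflexiveTransitive using (Star; ε; _◅_)
open import Relation.Binary.PropositionalEquality using (_≡_; _≢_; refl; sym; trans; cong; subst)
open import Relation.Nullary using (¬_; Dec; yes; no; ¬?)
open import Relation.Nullary.Decidable using (_×-dec_; _→-dec_)
open import Relation.Unary using (Pred; Decidable; _⊆_)
open import Relation.Unary.Properties using (U?; _∩?_; ∁?)

-- Counting decidable subsets of Fin n

count : ∀ {n} {P : Pred (Fin n) 0ℓ} → Decidable P → ℕ
count {zero}  P? = 0
count {suc n} P? with P? zero
... | yes _ = suc (count (P? ∘ suc))
... | no  _ = count (P? ∘ suc)

enum : ∀ {n} {P : Pred (Fin n) 0ℓ} (P? : Decidable P) → Fin (count P?) → Fin n
enum {suc n} P? i with P? zero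
enum {suc n} P? zero    | yes _ = zero
enum {suc n} P? (suc i) | yes _ = suc (enum (P? ∘ suc) i)
enum {suc n} P? i       | no  _ = suc (enum (P? ∘ suc) i)

enum-sat : ∀ {n} {P : Pred (Fin n) 0ℓ} (P? : Decidable P) i → P (enum P? i)
enum-sat {suc n} P? i with P? zero
enum-sat {suc n} P? zero    | yes p = p
enum-sat {suc n} P? (suc i) | yes _ = enum-sat (P? ∘ suc) i
enum-sat {suc n} P? i       | no  _ = enum-sat (P? ∘ suc) i

enum-injective : ∀ {n} {P : Pred (Fin n) 0ℓ} (P? : Decidable P) {i j} → enum P? i ≡ enum P? j → i ≡ j
enum-injective {suc n} P? {i} {j} eq with P? zero
enum-injective {suc n} P? {zero}  {zero}  eq | yes _ = refl
enum-injective {suc n} P? {suc i} {suc j} eq | yes _ = cong suc (enum-injective (P? ∘ suc) (suc-injective eq))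
enum-injective {suc n} P? {i}     {j}     eq | no  _ = enum-injective (P? ∘ suc) (suc-injective eq)

index : ∀ {n} {P : Pred (Fin n) 0ℓ} (P? : Decidable P) {x} → P x → Fin (count P?)
index {suc n} P? {x} px with P? zero
index {suc n} P? {zero}  px | yes _  = zero
index {suc n} P? {suc x} px | yes _  = suc (index (P? ∘ suc) px)
index {suc n} P? {zero}  px | no ¬p0 = ⊥-elim (¬p0 px)
index {suc n} P? {suc x} px | no _   = index (P? ∘ suc) px

enum-index : ∀ {n} {P : Pred (Fin n) 0ℓ} (P? : Decidable P) {x} (px : P x) → enum P? (index P? px) ≡ x
enum-index {suc n} P? {x} px with P? zero
enum-index {suc n} P? {zero}  px | yes _  = refl
enum-index {suc n} P? {suc x} px | yes _  = cong suc (enum-index (P? ∘ suc) px)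
enum-index {suc n} P? {zero}  px | no ¬p0 = ⊥-elim (¬p0 px)
enum-index {suc n} P? {suc x} px | no _   = cong suc (enum-index (P? ∘ suc) px)

count-≤-injection : ∀ {n n′} {P : Pred (Fin n) 0ℓ} {Q : Pred (Fin n′) 0ℓ}
  (P? : Decidable P) (Q? : Decidable Q) (R : Fin n → Fin n′ → Set) →
  (∀ {x} → P x → ∃ λ y → Q y × R x y) →
  (∀ {x x′ y} → P x → P x′ → R x y → R x′ y → x ≡ x′) →
  count P? ≤ count Q?
count-≤-injection P? Q? R total injective = injective⇒≤ {f = image} image-injective
  where
  image : Fin (count P?) → Fin (count Q?)
  image i = index Q? (proj₁ (proj₂ (total (enum-sat P? i))))
  image-injective : ∀ {i j} → image i ≡ image j → i ≡ j
  image-injective {i} {j} eq with total (enum-sat P? i) | total (enum-sat P? j)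
  ... | y , qy , r | y′ , qy′ , r′
    with trans (sym (enum-index Q? qy)) (trans (cong (enum Q?) eq) (enum-index Q? qy′))
  ...   | refl = enum-injective P? (injective (enum-sat P? i) (enum-sat P? j) r r′)

⊆⇒count≤ : ∀ {n} {P Q : Pred (Fin n) 0ℓ} (P? : Decidable P) (Q? : Decidable Q) →
  P ⊆ Q → count P? ≤ count Q?
⊆⇒count≤ P? Q? P⊆Q =
  count-≤-injection P? Q? _≡_ (λ px → _ , P⊆Q px , refl) (λ _ _ → λ { refl refl → refl })

⊂⇒count< : ∀ {n} {P Q : Pred (Fin n) 0ℓ} (P? : Decidable P) (Q? : Decidable Q) →
  P ⊆ Q → ∀ {z} → Q z → ¬ P z → count P? < count Q?
⊂⇒count< {suc n} P? Q? P⊆Q {z} qz ¬pz with P? zero | Q? zero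
... | yes p0 | no ¬q0 = ⊥-elim (¬q0 (P⊆Q p0))
... | no _   | yes _  = s≤s (⊆⇒count≤ (P? ∘ suc) (Q? ∘ suc) P⊆Q)
⊂⇒count< {suc n} P? Q? P⊆Q {zero}  qz ¬pz | yes p0 | yes _  = ⊥-elim (¬pz p0)
⊂⇒count< {suc n} P? Q? P⊆Q {suc z} qz ¬pz | yes _  | yes _  =
  s≤s (⊂⇒count< (P? ∘ suc) (Q? ∘ suc) P⊆Q qz ¬pz)
⊂⇒count< {suc n} P? Q? P⊆Q {zero}  qz ¬pz | no _   | no ¬q0 = ⊥-elim (¬q0 qz)
⊂⇒count< {suc n} P? Q? P⊆Q {suc z} qz ¬pz | no _   | no _   =
  ⊂⇒count< (P? ∘ suc) (Q? ∘ suc) P⊆Q qz ¬pz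

count-U : ∀ n → count {n} U? ≡ n
count-U zero    = refl
count-U (suc n) = cong suc (count-U n)

count-∁ : ∀ {n} {P : Pred (Fin n) 0ℓ} (P? : Decidable P) → count P? + count (∁? P?) ≡ n
count-∁ {zero}  P? = refl
count-∁ {suc n} P? with P? zero
... | yes _ = cong suc (count-∁ (P? ∘ suc))
... | no  _ = trans (+-suc _ _) (cong suc (count-∁ (P? ∘ suc)))

count-∩-∖ : ∀ {n} {P Q : Pred (Fin n) 0ℓ} (P? : Decidable P) (Q? : Decidable Q) →
  count P? ≡ count (P? ∩? Q?) + count (P? ∩? ∁? Q?)
count-∩-∖ {zero}  P? Q? = refl
count-∩-∖ {suc n} P? Q? with P? zero | Q? zero
... | yes _ | yes _ = cong suc (count-∩-∖ (P? ∘ suc) (Q? ∘ suc))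
... | yes _ | no  _ = trans (cong suc (count-∩-∖ (P? ∘ suc) (Q? ∘ suc))) (sym (+-suc _ _))
... | no  _ | yes _ = count-∩-∖ (P? ∘ suc) (Q? ∘ suc)
... | no  _ | no  _ = count-∩-∖ (P? ∘ suc) (Q? ∘ suc)

length-filter-tabulate : ∀ {n} {A : Set} {P : Pred A 0ℓ} (P? : Decidable P) (f : Fin n → A) →
  length (filter P? (tabulate f)) ≡ count (P? ∘ f)
length-filter-tabulate {zero}  P? f = refl
length-filter-tabulate {suc n} P? f with P? (f zero)
... | yes _ = cong suc (length-filter-tabulate P? (f ∘ suc))
... | no  _ = length-filter-tabulate P? (f ∘ suc)

-- Shortest paths and spanning forests

least : ∀ {P : Pred ℕ 0ℓ} → Decidable P →
  ∀ {l} → P l → ∃ λ d → P d × (∀ {i} → P i → d ≤ i)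
least P? {zero} p = 0 , p , λ _ → z≤n
least {P} P? {suc l} p with P? 0
... | yes p0 = 0 , p0 , λ _ → z≤n
... | no ¬p0 with least (P? ∘ suc) {l} p
...   | d , pd , min = suc d , pd , minimal
  where
  minimal : ∀ {i} → P i → suc d ≤ i
  minimal {zero}  p0 = ⊥-elim (¬p0 p0)
  minimal {suc i} pi = s≤s (min pi)

Path : ∀ {A : Set} → Rel A 0ℓ → ℕ → Rel A 0ℓ
Path E zero    x y = x ≡ y
Path E (suc l) x y = ∃ λ w → E x w × Path E l w y

module _ {n} {E : Rel (Fin n) 0ℓ} where

  path? : Decidable₂ E → ∀ l → Decidable₂ (Path E l)
  path? E? zero    x y = x ≟ y
  path? E? (suc l) x y = any? (λ w → E? x w ×-dec path? E? l w y)

  star⇒path : ∀ {x y} → Star E x y → ∃ λ l → Path E l x y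
  star⇒path ε = 0 , refl
  star⇒path (e ◅ s) with star⇒path s
  ... | l , p = suc l , _ , e , p

module SpanningForest {n k} {E : Rel (Fin n) 0ℓ} (E? : Decidable₂ E) (label : Fin n → Fin k)
  (label-surjective : Surjective _≡_ _≡_ label)
  (components : ∀ x y → (label x ≡ label y) ⇔ Star E x y) where

  root : Fin n → Fin n
  root x = proj₁ (label-surjective (label x))

  label-root : ∀ x → label (root x) ≡ label x
  label-root x = proj₂ (label-surjective (label x)) refl

  shortestPath : ∀ x → ∃ λ d → Path E d x (root x) × (∀ {l} → Path E l x (root x) → d ≤ l)
  shortestPath x =
    least (λ l → path? E? l x (root x))
      (proj₂ (star⇒path (Equivalence.to (components x (root x)) (sym (label-root x)))))

  depth : Fin n → ℕ
  depth x = proj₁ (shortestPath x)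

  depth≡0⇒root : ∀ {x} → depth x ≡ 0 → x ≡ root x
  depth≡0⇒root {x} d≡0 = subst (λ l → Path E l x (root x)) d≡0 (proj₁ (proj₂ (shortestPath x)))

  closerNeighbour : ∀ x {l} → depth x ≡ suc l → ∃ λ p → E x p × depth p ≤ l
  closerNeighbour x {l} d≡1+l with subst (λ l → Path E l x (root x)) d≡1+l (proj₁ (proj₂ (shortestPath x)))
  ... | p , e , path = p , e , proj₂ (proj₂ (shortestPath p)) path′
    where
    path′ : Path E l p (root p)
    path′ = subst (λ r → Path E l p (proj₁ (label-surjective r)))
                  (Equivalence.from (components x p) (e ◅ ε)) path

  roots-injective : ∀ {x y} → depth x ≡ 0 → depth y ≡ 0 → label x ≡ label y → x ≡ y
  roots-injective {x} {y} dx dy eq =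
    trans (depth≡0⇒root dx) (trans (cong (proj₁ ∘ label-surjective) eq) (sym (depth≡0⇒root dy)))

  stepToRoot : ∀ x → depth x ≡ 0 ⊎ ∃ λ p → E x p × depth p < depth x
  stepToRoot x with depth x in eq
  ... | zero  = inj₁ refl
  ... | suc l with closerNeighbour x eq
  ...   | p , e , p≤l = inj₂ (p , e , s≤s p≤l)

module _ {n} (D : Digraph n) where

  arc? : ∀ x y → Dec (Arc D x y)
  arc? x y = D x y Bool.≟ true

  walk? : ∀ l x y → Dec (Walk D l x y)
  walk? zero    x y = x ≟ y
  walk? (suc l) x y = any? (λ z → arc? x z ×-dec walk? l z y)

  cmEdge? : ∀ m x y → Dec (CmEdge D m x y)
  cmEdge? m x y = ¬? (x ≟ y) ×-dec any? (λ z → walk? m x z ×-dec walk? m y z)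

  cmEdge-sym : ∀ {m x y} → CmEdge D m x y → CmEdge D m y x
  cmEdge-sym (x≢y , z , wx , wy) = x≢y ∘ sym , z , wy , wx

  arc⇒nonSource : ∀ {x y} → Arc D x y → ¬ Source D y
  arc⇒nonSource {x} xy source with trans (sym xy) (source x)
  ... | ()

  walk-snoc : ∀ l {x w y} → Walk D l x w → Arc D w y → Walk D (suc l) x y
  walk-snoc zero    refl         wy = _ , wy , refl
  walk-snoc (suc l) (z , xz , w) wy = z , xz , walk-snoc l w wy

  walk-unsnoc : ∀ l {x y} → Walk D (suc l) x y → ∃ λ w → Walk D l x w × Arc D w y
  walk-unsnoc zero    (z , xz , refl) = _ , refl , xz
  walk-unsnoc (suc l) (z , xz , w) with walk-unsnoc l w
  ... | v , wv , vy = v , (z , xz , wv) , vy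

  walk⇒nonSource : ∀ l {x y} → Walk D (suc l) x y → ¬ Source D y
  walk⇒nonSource l w = arc⇒nonSource (proj₂ (proj₂ (walk-unsnoc l w)))

  walk-exists : OutdegPositive D → ∀ l x → ∃ (Walk D l x)
  walk-exists out zero    x = x , refl
  walk-exists out (suc l) x with out x
  ... | z , xz with walk-exists out l z
  ...   | y , w = y , z , xz , w

  triangleFree⇒atMostTwoPredators : ∀ {m} → CmTriangleFree D m →
    ∀ {x y w z} → x ≢ y → Walk D m x z → Walk D m y z → Walk D m w z → w ≡ x ⊎ w ≡ y
  triangleFree⇒atMostTwoPredators free {x} {y} {w} x≢y wx wy ww with w ≟ x | w ≟ y
  ... | yes w≡x | _       = inj₁ w≡x
  ... | no _    | yes w≡y = inj₂ w≡y
  ... | no w≢x  | no w≢y  =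
    ⊥-elim (free x y w ((x≢y , _ , wx , wy) , (w≢y ∘ sym , _ , wy , ww) , (w≢x ∘ sym , _ , wx , ww)))

nonSource? : ∀ {n} (D : Digraph n) x → Dec (¬ Source D x)
nonSource? D = ∁? (source? D)

module ParentPrey {n} (D : Digraph n) (j : ℕ) (free : CmTriangleFree D (suc j))
  (label : Fin n → Fin (numSources D)) (label-surjective : Surjective _≡_ _≡_ label)
  (components : ∀ x y → (label x ≡ label y) ⇔ CmConn D (suc j) x y) where

  private
    m : ℕ
    m = suc j

  open SpanningForest (cmEdge? D (suc j)) label label-surjective components public

  atMostTwo : ∀ {x y w z} → x ≢ y → Walk D m x z → Walk D m y z → Walk D m w z → w ≡ x ⊎ w ≡ y
  atMostTwo = triangleFree⇒atMostTwoPredators D free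

  ClimbsVia : Fin n → Fin n → Set
  ClimbsVia x z = ∃ λ p → x ≢ p × Walk D m x z × Walk D m p z × depth p < depth x

  -- junk value x at roots
  parentPrey : Fin n → Fin n
  parentPrey x with stepToRoot x
  ... | inj₁ _                     = x
  ... | inj₂ (_ , (_ , z , _) , _) = z

  climbsVia-parentPrey : ∀ {x} → depth x ≢ 0 → ClimbsVia x (parentPrey x)
  climbsVia-parentPrey {x} nonRoot with stepToRoot x
  ... | inj₁ isRoot                         = ⊥-elim (nonRoot isRoot)
  ... | inj₂ (p , (x≢p , _ , wx , wp) , p<x) = p , x≢p , wx , wp , p<x

  parentPrey-prey : ∀ {x} → depth x ≢ 0 → Walk D m x (parentPrey x)
  parentPrey-prey nx = proj₁ (proj₂ (proj₂ (climbsVia-parentPrey nx)))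

  parentPrey-injective : ∀ {x y} → depth x ≢ 0 → depth y ≢ 0 → parentPrey x ≡ parentPrey y → x ≡ y
  parentPrey-injective {x} {y} nx ny eq with x ≟ y | climbsVia-parentPrey nx | climbsVia-parentPrey ny
  ... | yes x≡y | _ | _ = x≡y
  ... | no x≢y | p , x≢p , wx , wp , p<x | q , y≢q , wy , wq , q<y
    with atMostTwo x≢p wx wp (subst (Walk D _ y) (sym eq) wy)
       | atMostTwo x≢p wx wp (subst (Walk D _ q) (sym eq) wq)
  ...   | inj₁ y≡x  | _         = ⊥-elim (x≢y (sym y≡x))
  ...   | inj₂ refl | inj₁ refl = ⊥-elim (<-asym p<x q<y)
  ...   | inj₂ refl | inj₂ refl = ⊥-elim (y≢q refl)

  root? : ∀ x → Dec (depth x ≡ 0)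
  root? x = depth x ℕ.≟ 0

  roots≤sources : count root? ≤ count (source? D)
  roots≤sources = begin
    count root?             ≤⟨ count-≤-injection root? U? (λ x i → label x ≡ i) (λ _ → _ , _ , refl)
                                 (λ rx ry ex ey → roots-injective rx ry (trans ex (sym ey))) ⟩
    count {numSources D} U? ≡⟨ count-U (numSources D) ⟩
    numSources D            ≡⟨ length-filter-tabulate (source? D) (λ x → x) ⟩
    count (source? D)       ∎
    where open ℕ.≤-Reasoning

  nonRoots<nonSources : ∀ {z} → ¬ Source D z → (∀ {x} → depth x ≢ 0 → parentPrey x ≢ z) →
    count (∁? root?) < count (nonSource? D)
  nonRoots<nonSources {z} nz missed = ℕ.≤-<-trans
    (count-≤-injection (∁? root?) (nonSource? D ∩? ∁? (_≟ z)) (λ x y → parentPrey x ≡ y)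
      (λ nx → _ , (walk⇒nonSource D j (parentPrey-prey nx) , missed nx) , refl)
      (λ nx ny ex ey → parentPrey-injective nx ny (trans ex (sym ey))))
    (⊂⇒count< (nonSource? D ∩? ∁? (_≟ z)) (nonSource? D) proj₁ nz (λ (_ , z≢z) → z≢z refl))

  -- Otherwise the non-roots inject into the non-sources other than z, which are too few.
  nonSource-parentPrey : ∀ {z} → ¬ Source D z → ∃ λ x → depth x ≢ 0 × parentPrey x ≡ z
  nonSource-parentPrey {z} nz with any? (λ x → ¬? (root? x) ×-dec (parentPrey x ≟ z))
  ... | yes hit = hit
  ... | no miss = ⊥-elim (<-irrefl refl (begin-strict
    n                                        ≡⟨ count-∁ root? ⟨
    count root? + count (∁? root?)           <⟨ ℕ.+-mono-≤-< roots≤sources (nonRoots<nonSources nz missed) ⟩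
    count (source? D) + count (nonSource? D) ≡⟨ count-∁ (source? D) ⟩
    n                                        ∎))
    where
    open ℕ.≤-Reasoning
    missed : ∀ {x} → depth x ≢ 0 → parentPrey x ≢ z
    missed nx eq = miss (_ , nx , eq)

  nonSource-climbedVia : ∀ {z} → ¬ Source D z → ∃ λ x → ClimbsVia x z
  nonSource-climbedVia nz with nonSource-parentPrey nz
  ... | x , nx , refl = x , climbsVia-parentPrey nx

  predatorsOf-sharedPrey : ∀ {x x′ z z′ v} → x ≢ x′ →
    Walk D m x z → Walk D m x′ z → Walk D m x z′ → Walk D m x′ z′ →
    Walk D m v z → Walk D m v z′
  predatorsOf-sharedPrey x≢x′ wxz wx′z wxz′ wx′z′ wv with atMostTwo x≢x′ wxz wx′z wv
  ... | inj₁ refl = wxz′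
  ... | inj₂ refl = wx′z′

  commonPrey-unique : ∀ {x x′ z z′} → x ≢ x′ →
    Walk D m x z → Walk D m x′ z → Walk D m x z′ → Walk D m x′ z′ → z ≡ z′
  commonPrey-unique x≢x′ wxz wx′z wxz′ wx′z′
    with nonSource-parentPrey (walk⇒nonSource D j wxz) | nonSource-parentPrey (walk⇒nonSource D j wxz′)
  ... | y , ny , refl | y′ , ny′ , refl
    with climbsVia-parentPrey ny | climbsVia-parentPrey ny′
  ...   | p , _ , wy , wp , p<y | p′ , y′≢p′ , wy′ , wp′ , p′<y′
    with atMostTwo y′≢p′ wy′ wp′ (predatorsOf-sharedPrey x≢x′ wxz wx′z wxz′ wx′z′ wy)
       | atMostTwo y′≢p′ wy′ wp′ (predatorsOf-sharedPrey x≢x′ wxz wx′z wxz′ wx′z′ wp)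
  ... | inj₁ refl | _         = refl
  ... | inj₂ refl | inj₁ refl = ⊥-elim (<-asym p<y p′<y′)
  ... | inj₂ refl | inj₂ refl = ⊥-elim (<-irrefl refl p<y)

module StarStructure {n} (D : Digraph n) (outdeg : OutdegPositive D) (i : ℕ) (free : CmTriangleFree D (suc (suc i)))
  (label : Fin n → Fin (numSources D)) (label-surjective : Surjective _≡_ _≡_ label)
  (components : ∀ x y → (label x ≡ label y) ⇔ CmConn D (suc (suc i)) x y) where

  open ParentPrey D (suc i) free label label-surjective components

  m : ℕ
  m = suc (suc i)

  Forked : Fin n → Set
  Forked u = ∃₂ λ a b → a ≢ b × Walk D (suc i) a u × Walk D (suc i) b u

  forked? : ∀ u → Dec (Forked u)
  forked? u =
    any? λ a → any? λ b → ¬? (a ≟ b) ×-dec walk? D (suc i) a u ×-dec walk? D (suc i) b u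

  forked⇒nonSource : ∀ {u} → Forked u → ¬ Source D u
  forked⇒nonSource (_ , _ , _ , wa , _) = walk⇒nonSource D i wa

  forked-uniquePrey : ∀ {u z z′} → Forked u → Arc D u z → Arc D u z′ → z ≡ z′
  forked-uniquePrey (a , b , a≢b , wa , wb) uz uz′ =
    commonPrey-unique a≢b (walk-snoc D _ wa uz) (walk-snoc D _ wb uz)
                          (walk-snoc D _ wa uz′) (walk-snoc D _ wb uz′)

  predators⊆⇒≡ : ∀ {u u′} → ¬ Source D u →
    (∀ {t} → Walk D (suc i) t u → Walk D (suc i) t u′) → u ≡ u′
  predators⊆⇒≡ nu sub with nonSource-climbedVia nu
  ... | x , p , x≢p , (t , xt , wt) , (t′ , pt′ , wt′) , _ =
    commonPrey-unique x≢p (t , xt , wt) (t′ , pt′ , wt′) (t , xt , sub wt) (t′ , pt′ , sub wt′)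

  forked-arc-injective : ∀ {w w′ z} → Forked w → Forked w′ →
    Arc D w z → Arc D w′ z → w ≡ w′
  forked-arc-injective {w} {w′} (a , b , a≢b , wa , wb) forked′ wz w′z =
    sym (predators⊆⇒≡ (forked⇒nonSource forked′) predator′⇒predator)
    where
    predator′⇒predator : ∀ {t} → Walk D (suc i) t w′ → Walk D (suc i) t w
    predator′⇒predator wt
      with atMostTwo a≢b (walk-snoc D _ wa wz) (walk-snoc D _ wb wz) (walk-snoc D _ wt w′z)
    ... | inj₁ refl = wa
    ... | inj₂ refl = wb

  -- The counting below shows that no vertex is lonely.
  Lonely : Fin n → Set
  Lonely u = ¬ Source D u × ¬ Forked u

  lonely? : ∀ u → Dec (Lonely u)
  lonely? = nonSource? D ∩? ∁? forked?

  lonely-uniquePredator : ∀ {u a b} → Lonely u → Walk D (suc i) a u → Walk D (suc i) b u → a ≡ b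
  lonely-uniquePredator {a = a} {b} (_ , ¬forked) wa wb with a ≟ b
  ... | yes a≡b = a≡b
  ... | no a≢b  = ⊥-elim (¬forked (a , b , a≢b , wa , wb))

  ReachesLonely : Fin n → Set
  ReachesLonely a = ∃ λ u → Lonely u × Walk D (suc i) a u

  reachesLonely? : ∀ a → Dec (ReachesLonely a)
  reachesLonely? a = any? λ u → lonely? u ×-dec walk? D (suc i) a u

  NoForkedPredator : Fin n → Set
  NoForkedPredator z = ∀ w → Arc D w z → ¬ Forked w

  LonelyFed : Fin n → Set
  LonelyFed z = ¬ Source D z × NoForkedPredator z

  noForkedPredator? : ∀ z → Dec (NoForkedPredator z)
  noForkedPredator? z = all? λ w → arc? D w z →-dec ¬? (forked? w)

  lonelyFed? : ∀ z → Dec (LonelyFed z)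
  lonelyFed? = nonSource? D ∩? noForkedPredator?

  lonelyFed-predator⇒reachesLonely : ∀ {x z} → LonelyFed z → Walk D m x z → ReachesLonely x
  lonelyFed-predator⇒reachesLonely (_ , fed) wx with walk-unsnoc D (suc i) wx
  ... | w , xw , wz = w , (walk⇒nonSource D i xw , fed w wz) , xw

  lonely≤lonelyFed : count lonely? ≤ count lonelyFed?
  lonely≤lonelyFed = ℕ.+-cancelˡ-≤ (count (nonSource? D ∩? forked?)) _ _ (begin
    count (nonSource? D ∩? forked?) + count lonely?                 ≡⟨ count-∩-∖ (nonSource? D) forked? ⟨
    count (nonSource? D)                                            ≡⟨ count-∩-∖ (nonSource? D) noForkedPredator? ⟩
    count lonelyFed? + count (nonSource? D ∩? ∁? noForkedPredator?) ≤⟨ ℕ.+-monoʳ-≤ _ fedByForked≤forked ⟩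
    count lonelyFed? + count (nonSource? D ∩? forked?)              ≡⟨ ℕ.+-comm (count lonelyFed?) _ ⟩
    count (nonSource? D ∩? forked?) + count lonelyFed?              ∎)
    where
    open ℕ.≤-Reasoning
    fedByForked : ∀ {z} → ¬ NoForkedPredator z → ∃ λ w → Arc D w z × Forked w
    fedByForked {z} ¬fed with any? (λ w → arc? D w z ×-dec forked? w)
    ... | yes found = found
    ... | no none   = ⊥-elim (¬fed λ w wz forked → none (w , wz , forked))
    fedByForked≤forked : count (nonSource? D ∩? ∁? noForkedPredator?) ≤ count (nonSource? D ∩? forked?)
    fedByForked≤forked = count-≤-injection _ _ (λ z w → Arc D w z × Forked w)
      (λ (_ , ¬fed) → let (w , wz , forked) = fedByForked ¬fed in w , (forked⇒nonSource forked , forked) , wz , forked)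
      (λ _ _ (wz , forked) (wz′ , _) → forked-uniquePrey forked wz wz′)

  reachesLonely≤lonely : count reachesLonely? ≤ count lonely?
  reachesLonely≤lonely = count-≤-injection reachesLonely? lonely? (λ a u → Lonely u × Walk D (suc i) a u)
    (λ (u , lonely , au) → u , lonely , lonely , au)
    (λ _ _ (lonely , au) (_ , a′u) → lonely-uniquePredator lonely au a′u)

  -- LonelyFed ↪ ReachesLonely (via parent preys) ↪ Lonely and #Lonely ≤ #LonelyFed force the
  -- first injection to be onto, so a is hit.
  reachesLonely-parentPrey : ∀ {a} → ReachesLonely a →
    ∃ λ z → LonelyFed z × depth a ≢ 0 × parentPrey a ≡ z
  reachesLonely-parentPrey {a} reaches
    with any? (λ z → lonelyFed? z ×-dec ¬? (root? a) ×-dec (parentPrey a ≟ z))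
  ... | yes found = found
  ... | no miss = ⊥-elim (<-irrefl refl (begin-strict
    count lonelyFed?     <⟨ fed<reaches ⟩
    count reachesLonely? ≤⟨ reachesLonely≤lonely ⟩
    count lonely?        ≤⟨ lonely≤lonelyFed ⟩
    count lonelyFed?     ∎))
    where
    open ℕ.≤-Reasoning
    climber : ∀ {z} → LonelyFed z → ∃ λ x → (ReachesLonely x × x ≢ a) × depth x ≢ 0 × parentPrey x ≡ z
    climber fed with nonSource-parentPrey (proj₁ fed)
    ... | x , nx , refl =
      x , (lonelyFed-predator⇒reachesLonely fed (parentPrey-prey nx) , λ { refl → miss (_ , fed , nx , refl) }) ,
      nx , refl
    fed<reaches : count lonelyFed? < count reachesLonely?
    fed<reaches = ℕ.≤-<-trans
      (count-≤-injection lonelyFed? (reachesLonely? ∩? ∁? (_≟ a))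
        (λ z x → depth x ≢ 0 × parentPrey x ≡ z) climber (λ _ _ (_ , ex) (_ , ex′) → trans (sym ex) ex′))
      (⊂⇒count< (reachesLonely? ∩? ∁? (_≟ a)) reachesLonely? proj₁ reaches λ (_ , a≢a) → a≢a refl)

  -- The parent of a vertex reaching a lonely vertex reaches one too, at smaller depth.
  ¬reachesLonely : ∀ a → ¬ ReachesLonely a
  ¬reachesLonely a = descend a (<-wellFounded (depth a))
    where
    descend : ∀ a → Acc _<_ (depth a) → ¬ ReachesLonely a
    descend a (acc smaller) reaches with reachesLonely-parentPrey reaches
    ... | z , fed , na , refl with climbsVia-parentPrey na
    ...   | p , _ , _ , wp , p<a = descend p (smaller p<a) (lonelyFed-predator⇒reachesLonely fed wp)

  nonSource⇒forked : ∀ {u} → ¬ Source D u → Forked u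
  nonSource⇒forked {u} nu with forked? u
  ... | yes forked = forked
  ... | no ¬forked with nonSource-climbedVia nu
  ...   | _ , _ , _ , (t , _ , tu) , _ = ⊥-elim (¬reachesLonely t (u , (nu , ¬forked) , tu))

  nonSource-uniquePrey : ∀ {u z z′} → ¬ Source D u → Arc D u z → Arc D u z′ → z ≡ z′
  nonSource-uniquePrey nu = forked-uniquePrey (nonSource⇒forked nu)

  nonSource-arc-injective : ∀ {w w′ z} → ¬ Source D w → ¬ Source D w′ →
    Arc D w z → Arc D w′ z → w ≡ w′
  nonSource-arc-injective nw nw′ =
    forked-arc-injective (nonSource⇒forked nw) (nonSource⇒forked nw′)

  nonSource-walk-injective : ∀ l {t s y} → ¬ Source D t → ¬ Source D s →
    Walk D l t y → Walk D l s y → t ≡ s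
  nonSource-walk-injective zero    _  _  refl refl = refl
  nonSource-walk-injective (suc l) nt ns (_ , tt′ , t′y) (_ , ss′ , s′y)
    with nonSource-walk-injective l (arc⇒nonSource D tt′) (arc⇒nonSource D ss′) t′y s′y
  ... | refl = nonSource-arc-injective nt ns tt′ ss′

  nonSource-nonSourcePredator : ∀ {z} → ¬ Source D z → ∃ λ w → ¬ Source D w × Arc D w z
  nonSource-nonSourcePredator nz with nonSource-climbedVia nz
  ... | _ , _ , _ , xz , _ with walk-unsnoc D (suc i) xz
  ...   | w , xw , wz = w , walk⇒nonSource D i xw , wz

  PredatorsAre : Fin n → Fin n → Fin n → Set
  PredatorsAre z x p = Arc D x z × Arc D p z × (∀ r → Arc D r z → r ≡ x ⊎ r ≡ p)

  predators-viaLaterPrey : ∀ {z z′ x p} → ¬ Source D z → Walk D (suc i) z z′ →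
    x ≢ p → Walk D m x z′ → Walk D m p z′ → PredatorsAre z x p
  predators-viaLaterPrey {z} {z′} nz zz′ x≢p xz′ pz′ =
    toArc xz′ , toArc pz′ , λ r rz → atMostTwo x≢p xz′ pz′ (z , rz , zz′)
    where
    toArc : ∀ {y} → Walk D m y z′ → Arc D y z
    toArc (t , yt , tz′) with nonSource-walk-injective (suc i) (arc⇒nonSource D yt) nz tz′ zz′
    ... | refl = yt

  predatorsAre-sourceAndNonSource : ∀ {z x p} → ¬ Source D z → x ≢ p → PredatorsAre z x p →
    ∃₂ λ σ g → Source D σ × ¬ Source D g × PredatorsAre z σ g
  predatorsAre-sourceAndNonSource {x = x} {p} nz x≢p (xz , pz , only) with source? D x | source? D p
  ... | yes sx | no np  = x , p , sx , np , xz , pz , only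
  ... | no nx  | yes sp = p , x , sp , nx , pz , xz , λ r rz → Sum.swap (only r rz)
  ... | no nx  | no np  = ⊥-elim (x≢p (nonSource-arc-injective nx np xz pz))
  ... | yes sx | yes sp with nonSource-nonSourcePredator nz
  ...   | w , nw , wz with only w wz
  ...     | inj₁ refl = ⊥-elim (nw sx)
  ...     | inj₂ refl = ⊥-elim (nw sp)

  nonSource-predators : ∀ {z} → ¬ Source D z →
    ∃₂ λ σ g → Source D σ × ¬ Source D g × PredatorsAre z σ g
  nonSource-predators {z} nz with walk-exists D outdeg (suc i) z
  ... | z′ , zz′ with nonSource-climbedVia (walk⇒nonSource D i zz′)
  ...   | x , p , x≢p , xz′ , pz′ , _ =
    predatorsAre-sourceAndNonSource nz x≢p (predators-viaLaterPrey nz zz′ x≢p xz′ pz′)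

  sources-arc-injective : ∀ {a b t} → Source D a → Source D b → Arc D a t → Arc D b t → a ≡ b
  sources-arc-injective sa sb at bt with nonSource-predators (arc⇒nonSource D at)
  ... | _ , _ , _ , ng , _ , _ , only with only _ at | only _ bt
  ...   | inj₁ refl | inj₁ refl = refl
  ...   | inj₂ refl | _         = ⊥-elim (ng sa)
  ...   | _         | inj₂ refl = ⊥-elim (ng sb)

  cmEdge-fromNonSource : ∀ {y x} → ¬ Source D y → CmEdge D m y x →
    Source D x × ∃ λ t → Arc D y t × Arc D x t
  cmEdge-fromNonSource ny (y≢x , _ , (t , yt , tz) , (t′ , xt′ , t′z))
    with nonSource-walk-injective (suc i) (arc⇒nonSource D yt) (arc⇒nonSource D xt′) tz t′z
  ... | refl with nonSource-predators (arc⇒nonSource D yt)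
  ...   | _ , _ , sσ , _ , _ , _ , only with only _ xt′ | only _ yt
  ...     | inj₁ refl | _         = sσ , t , yt , xt′
  ...     | inj₂ refl | inj₁ refl = ⊥-elim (ny sσ)
  ...     | inj₂ refl | inj₂ refl = ⊥-elim (y≢x refl)

  nonSource-cmNeighbour-unique : ∀ {y x x′} → ¬ Source D y →
    CmEdge D m y x → CmEdge D m y x′ → x ≡ x′
  nonSource-cmNeighbour-unique ny e e′ with cmEdge-fromNonSource ny e | cmEdge-fromNonSource ny e′
  ... | sx , t , yt , xt | sx′ , t′ , yt′ , x′t′ with nonSource-uniquePrey ny yt yt′
  ...   | refl = sources-arc-injective sx sx′ xt x′t′

  sources-nonadjacent : ∀ {a b} → Source D a → Source D b → ¬ CmEdge D m a b
  sources-nonadjacent sa sb (a≢b , _ , (t , at , tz) , (t′ , bt′ , t′z))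
    with nonSource-walk-injective (suc i) (arc⇒nonSource D at) (arc⇒nonSource D bt′) tz t′z
  ... | refl = a≢b (sources-arc-injective sa sb at bt′)

  source-cmNeighbour-nonSource : ∀ {s y} → Source D s → CmEdge D m s y → ¬ Source D y
  source-cmNeighbour-nonSource ss sy sourceY = sources-nonadjacent ss sourceY sy

  StarAround : Fin n → Fin n → Set
  StarAround s y = y ≡ s ⊎ CmEdge D m s y

  starAround-closed : ∀ {s} → Source D s →
    ∀ {y y′} → StarAround s y → CmConn D m y y′ → StarAround s y′
  starAround-closed ss y∈ ε = y∈
  starAround-closed ss (inj₁ refl) (e ◅ path) = starAround-closed ss (inj₂ e) path
  starAround-closed ss (inj₂ sy) (e ◅ path) =
    starAround-closed ss
      (inj₁ (nonSource-cmNeighbour-unique (source-cmNeighbour-nonSource ss sy) e (cmEdge-sym D sy))) path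

  source-hasCmNeighbour : ∀ {s} → Source D s → ∃ λ y → CmEdge D m s y
  source-hasCmNeighbour {s} ss with walk-exists D outdeg m s
  ... | z , sz with nonSource-climbedVia (walk⇒nonSource D (suc i) sz)
  ...   | x , p , x≢p , xz , pz , _ with x ≟ s
  ...     | yes refl = p , x≢p , z , sz , pz
  ...     | no x≢s   = x , x≢s ∘ sym , z , sz , xz

  cmConnectedToSource : ∀ x → ∃ λ s → Source D s × CmConn D m s x
  cmConnectedToSource x with source? D x
  ... | yes sx = x , sx , ε
  ... | no nx with outdeg x
  ...   | t , xt with nonSource-predators (arc⇒nonSource D xt) | walk-exists D outdeg (suc i) t
  ...     | σ , _ , sσ , _ , σt , _ | z , tz =
    σ , sσ , ((λ { refl → nx sσ }) , z , (t , σt , tz) , (t , xt , tz)) ◅ ε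

  starAround-edge-touchesCenter : ∀ {s y z} → Source D s → StarAround s y → StarAround s z →
    CmEdge D m y z → y ≡ s ⊎ z ≡ s
  starAround-edge-touchesCenter ss (inj₁ y≡s) _ _ = inj₁ y≡s
  starAround-edge-touchesCenter ss _ (inj₁ z≡s) _ = inj₂ z≡s
  starAround-edge-touchesCenter ss (inj₂ sy) (inj₂ sz) yz =
    ⊥-elim (source-cmNeighbour-nonSource ss sz
             (proj₁ (cmEdge-fromNonSource (source-cmNeighbour-nonSource ss sy) yz)))

  starAround-spoke : ∀ {s y} → StarAround s y → y ≢ s → CmEdge D m s y
  starAround-spoke (inj₁ y≡s) y≢s = ⊥-elim (y≢s y≡s)
  starAround-spoke (inj₂ sy)  _   = sy

  starAround-edge⇔ : ∀ {s y z} → Source D s → StarAround s y → StarAround s z →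
    CmEdge D m y z ⇔ (y ≢ z × (y ≡ s ⊎ z ≡ s))
  starAround-edge⇔ ss y∈ z∈ = mk⇔
    (λ yz → proj₁ yz , starAround-edge-touchesCenter ss y∈ z∈ yz)
    λ { (y≢z , inj₁ refl) → starAround-spoke z∈ (y≢z ∘ sym)
      ; (y≢z , inj₂ refl) → cmEdge-sym D (starAround-spoke y∈ y≢z) }

  componentIsStar : ∀ x → ComponentIsSourceCenteredStar D m x
  componentIsStar x with cmConnectedToSource x
  ... | s , ss , s⇝x with source-hasCmNeighbour ss
  ...   | t , st = s , ss , s⇝x , (t , st ◅ ε , proj₁ st ∘ sym) , λ y z s⇝y s⇝z →
    starAround-edge⇔ ss (starAround-closed ss (inj₁ refl) s⇝y) (starAround-closed ss (inj₁ refl) s⇝z)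

  nonSource-exactlyTwoPredators : ∀ {w} → ¬ Source D w → ExactlyTwoPredators D w
  nonSource-exactlyTwoPredators nw with nonSource-predators nw
  ... | σ , g , sσ , ng , σw , gw , only = σ , g , (λ { refl → ng sσ }) , σw , gw , only

  nonSource-hasUniquePrey : ∀ {x} → ¬ Source D x →
    ∃ λ y → Arc D x y × (∀ y′ → Arc D x y′ → y′ ≡ y)
  nonSource-hasUniquePrey {x} nx with outdeg x
  ... | y , xy = y , xy , λ y′ xy′ → nonSource-uniquePrey nx xy′ xy

  source-exists : Fin n → ∃ (Source D)
  source-exists x with cmConnectedToSource x
  ... | s , ss , _ = s , ss

  starGenerating : WeaklyConnected D → StarGenerating D
  starGenerating connected =
    connected ,
    source-exists (proj₁ connected) ,
    (λ _ _ _ vw → nonSource-exactlyTwoPredators (arc⇒nonSource D vw)) ,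
    (λ _ _ su sv u≢v (_ , uw , vw) → u≢v (sources-arc-injective su sv uw vw)) ,
    λ _ nx → nonSource-hasUniquePrey nx , nonSource-predators nx

theorem2p7 : (m n : ℕ) → m ≥ 2 → (D : Digraph n) → OutdegPositive D → WeaklyConnected D → CmTriangleFree D m → CmHasComponents D m (numSources D) → ((x : Fin n) → ComponentIsSourceCenteredStar D m x) × StarGenerating D
theorem2p7 (suc zero) n (s≤s ()) D outdeg connected free components
theorem2p7 (suc (suc i)) n _ D outdeg connected free (label , label-surjective , components) =
  componentIsStar , starGenerating connected
  where open StarStructure D outdeg i free label label-surjective components
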